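{- Let $a,b,n,k$ be positive integers with $1\le k\le n$, and let $$S_{a,b}(n,k):=\sum_{0\le i_1<\cdots<i_k\le n-1}\prod_{j=1}^k\frac{1}{ai_j+b}.$$ If there is a prime $p$ satisfying $\frac{n}{k+1}<p\le \frac{n}{k}$ and $p>ak+2a+\frac{2b}{p}$, then $v_p(S_{a,b}(n,k))=-k$.
   Context: For a prime $p$, $v_p$ denotes the $p$-adic valuation on $\mathbb{Q}$: for nonzero $x\in\mathbb{Q}$, $v_p(x)=m$ where $x=p^m u/w$ with integers $u,w$ not divisible by $p$. -}

module Defs where

open import Data.Nat as ℕ using (ℕ; zero; suc; NonZero)
open import Data.Nat.Properties as ℕP using ()
open import Data.Integer as ℤ using (ℤ; +_; -[1+_])
open import Data.Rational as ℚ using (ℚ; _/_; 0ℚ; 1ℚ)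
open import Data.List using (List; []; _∷_; map; upTo)
open import Data.Product using (∃; _×_; _,_)
open import Relation.Binary.PropositionalEquality using (_≡_)
open import Relation.Nullary using (¬_)
open import Data.Integer.Divisibility using (_∣_)

esym : ℕ → List ℚ → ℚ
esym zero    _        = 1ℚ
esym (suc k) []       = 0ℚ
esym (suc k) (x ∷ xs) = x ℚ.* esym k xs ℚ.+ esym (suc k) xs

nonZero-ai+b : ∀ a i b → .{{NonZero b}} → NonZero (a ℕ.* i ℕ.+ b)
nonZero-ai+b a i (suc b) = ℕ.>-nonZero (ℕP.≤-trans (ℕ.s≤s ℕ.z≤n) (ℕP.m≤n+m (suc b) (a ℕ.* i)))

term : (a b : ℕ) → .{{NonZero b}} → ℕ → ℚ
term a b i = (+ 1 / (a ℕ.* i ℕ.+ b)) {{nonZero-ai+b a i b}}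

S : (a b n k : ℕ) → .{{NonZero b}} → ℚ
S a b n k = esym k (map (term a b) (upTo n))

pow : (p : ℕ) → .{{NonZero p}} → ℤ → ℚ
pow p (+ m)      = (+ (p ℕ.^ m)) / 1
pow p -[1+ m ]   = (+ 1 / (p ℕ.^ suc m)) {{ℕP.m^n≢0 p (suc m)}}

-- v_p(x) = m : x = p^m u / w with integers u, w not divisible by p  (x ≠ 0)
-- (written as x * w = p^m * u, w ≠ 0, to avoid a division side condition)
HasValuation : (p : ℕ) → .{{NonZero p}} → ℚ → ℤ → Set
HasValuation p x m =
  ¬ (x ≡ 0ℚ) ×
  ∃ λ (u : ℤ) → ∃ λ (w : ℤ) →
    ¬ (w ≡ + 0) × ¬ ((+ p) ∣ u) × ¬ ((+ p) ∣ w) ×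
    (x ℚ.* (w / 1) ≡ pow p m ℚ.* (u / 1))

{-# OPTIONS --safe #-}
module Submission where

-- Put d i = a i + b. Clearing denominators, S · Π d i is the sum over k-sets T of
-- Π_{i ∉ T} d i. As p ∤ a, the multiples of p among d 0, …, d (n - 1) sit exactly p
-- apart; the hypotheses force their number to be k + ε with ε ∈ {0, 1} and their
-- quotients by p to be m, m + a, …, m + c a with every term, 2m + c a and c + 1
-- below p. A term of the sum has p-valuation ≥ ε, with equality exactly when T
-- consists of multiples, and those terms add up to p^ε times a unit (the p-free
-- part of Π d i times 1, or times the progression sum (c + 1)(2m + c a)/2 when
-- ε = 1). Since v_p(Π d i) = k + ε, we get v_p(S) = ε - (k + ε) = -k.

open import Defs
open import Data.Nat as ℕ using (ℕ; NonZero; _≤_; _<_)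
open import Data.Nat.Primality using (Prime)
open import Data.Integer as ℤ using (+_)
open import Data.Rational as ℚ using (_/_)

open import Data.Nat using (zero; suc; _+_; _*_; _^_; z<s; s<s; _∸_; >-nonZero; >-nonZero⁻¹)
import Data.Nat.Properties as ℕP
open import Data.Nat.DivMod using (_%_; m≡m%n+[m/n]*n; m%n<n) renaming (_/_ to _div_)
open import Data.Nat.Divisibility
  using (_∣_; _∤_; divides; _∣?_; _∣0; ∣m+n∣m⇒∣n; m∣m*n; n∣m*n; ∣n⇒∣m*n; >⇒∤)
open import Data.Nat.Primality using (euclidsLemma; prime⇒nonTrivial)
open import Data.Nat.Coprimality using (Coprime; coprime-Bézout; prime⇒coprime)
open import Data.Nat.GCD using (module Bézout)
open import Data.Nat.ListAction using (product)
open import Data.Nat.Tactic.RingSolver using (solve-∀)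
import Data.Integer.Properties as ℤP
open import Data.Rational using (ℚ; 0ℚ; 1ℚ; toℚᵘ; fromℚᵘ)
import Data.Rational.Properties as ℚP
open import Data.Rational.Unnormalised as ℚᵘ using (mkℚᵘ; *≡*; *<*; *≤*)
import Data.Rational.Unnormalised.Properties as ℚᵘP
open import Data.Rational.Solver using (module +-*-Solver)
open import Data.List using (List; []; _∷_; _++_; map; length; applyUpTo; upTo)
open import Data.List.Properties using (map-upTo)
open import Data.List.Relation.Unary.All using (All; []; _∷_)
open import Data.List.Relation.Unary.All.Properties using (applyUpTo⁺₁)
open import Data.Product using (∃-syntax; _×_; _,_)
open import Data.Sum using ([_,_]′)
open import Data.Empty using (⊥-elim)
open import Function using (_∘_)
open import Relation.Nullary using (¬_; yes; no)
open import Relation.Binary.PropositionalEquality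

toℚ : ℕ → ℚ
toℚ m = + m / 1

/-toℚᵘ : ∀ i n .{{_ : NonZero n}} → toℚᵘ (i / n) ℚᵘ.≃ i ℚᵘ./ n
/-toℚᵘ i (suc n) = ℚP.toℚᵘ-fromℚᵘ (mkℚᵘ i n)

/-<-/⇒ : ∀ i j m n .{{_ : NonZero m}} .{{_ : NonZero n}} →
         i / m ℚ.< j / n → i ℤ.* + n ℤ.< j ℤ.* + m
/-<-/⇒ i j m n i/m<j/n
  with ℚᵘP.<-respˡ-≃ (/-toℚᵘ i m) (ℚᵘP.<-respʳ-≃ (/-toℚᵘ j n) (ℚP.toℚᵘ-mono-< i/m<j/n))
/-<-/⇒ i j (suc _) (suc _) _ | *<* in<jm = in<jm

/-≤-/⇒ : ∀ i j m n .{{_ : NonZero m}} .{{_ : NonZero n}} →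
         i / m ℚ.≤ j / n → i ℤ.* + n ℤ.≤ j ℤ.* + m
/-≤-/⇒ i j m n i/m≤j/n
  with ℚᵘP.≤-respˡ-≃ (/-toℚᵘ i m) (ℚᵘP.≤-respʳ-≃ (/-toℚᵘ j n) (ℚP.toℚᵘ-mono-≤ i/m≤j/n))
/-≤-/⇒ i j (suc _) (suc _) _ | *≤* in≤jm = in≤jm

fromℚᵘ-homo-+ : ∀ x y → fromℚᵘ (x ℚᵘ.+ y) ≡ fromℚᵘ x ℚ.+ fromℚᵘ y
fromℚᵘ-homo-+ x y = ℚP.toℚᵘ-injective (ℚᵘP.≃-trans (ℚP.toℚᵘ-fromℚᵘ (x ℚᵘ.+ y))
  (ℚᵘP.≃-sym (ℚᵘP.≃-trans (ℚP.toℚᵘ-homo-+ (fromℚᵘ x) (fromℚᵘ y))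
    (ℚᵘP.+-cong (ℚP.toℚᵘ-fromℚᵘ x) (ℚP.toℚᵘ-fromℚᵘ y)))))

fromℚᵘ-homo-* : ∀ x y → fromℚᵘ (x ℚᵘ.* y) ≡ fromℚᵘ x ℚ.* fromℚᵘ y
fromℚᵘ-homo-* x y = ℚP.toℚᵘ-injective (ℚᵘP.≃-trans (ℚP.toℚᵘ-fromℚᵘ (x ℚᵘ.* y))
  (ℚᵘP.≃-sym (ℚᵘP.≃-trans (ℚP.toℚᵘ-homo-* (fromℚᵘ x) (fromℚᵘ y))
    (ℚᵘP.*-cong (ℚP.toℚᵘ-fromℚᵘ x) (ℚP.toℚᵘ-fromℚᵘ y)))))

/-+-/ : ∀ i j m n .{{_ : NonZero m}} .{{_ : NonZero n}} →
        i / m ℚ.+ j / n ≡ ((i ℤ.* + n ℤ.+ j ℤ.* + m) / (m * n)) {{ℕP.m*n≢0 m n}}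
/-+-/ i j (suc m) (suc n) = sym (fromℚᵘ-homo-+ (mkℚᵘ i m) (mkℚᵘ j n))

toℚ-* : ∀ m n → toℚ m ℚ.* toℚ n ≡ toℚ (m * n)
toℚ-* m n = trans (sym (fromℚᵘ-homo-* (mkℚᵘ (+ m) 0) (mkℚᵘ (+ n) 0)))
  (cong (_/ 1) (sym (ℤP.pos-* m n)))

toℚ-+ : ∀ m n → toℚ m ℚ.+ toℚ n ≡ toℚ (m + n)
toℚ-+ m n = trans (sym (fromℚᵘ-homo-+ (mkℚᵘ (+ m) 0) (mkℚᵘ (+ n) 0)))
  (cong (_/ 1) (trans (cong₂ ℤ._+_ (ℤP.*-identityʳ (+ m)) (ℤP.*-identityʳ (+ n))) (sym (ℤP.pos-+ m n))))

toℚ-injective : ∀ {m n} → toℚ m ≡ toℚ n → m ≡ n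
toℚ-injective {m} {n} eq with ℚP.fromℚᵘ-injective {mkℚᵘ (+ m) 0} {mkℚᵘ (+ n) 0} eq
... | *≡* m*1≡n*1 = ℤP.+-injective (trans (sym (ℤP.*-identityʳ (+ m))) (trans m*1≡n*1 (ℤP.*-identityʳ (+ n))))

1/n*toℚ[n]≡1 : ∀ n .{{_ : NonZero n}} → (+ 1 / n) ℚ.* toℚ n ≡ 1ℚ
1/n*toℚ[n]≡1 (suc n) = trans (sym (fromℚᵘ-homo-* (mkℚᵘ (+ 1) n) (mkℚᵘ (+ suc n) 0)))
  (ℚP.fromℚᵘ-cong {mkℚᵘ (+ 1) n ℚᵘ.* mkℚᵘ (+ suc n) 0} {mkℚᵘ (+ 1) 0}
    (*≡* (trans (ℤP.*-identityʳ _) (cong (λ m → + suc (m + 0)) (sym (ℕP.*-identityʳ n))))))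

*-toℚ-cancel : ∀ x w u A B .{{_ : NonZero A}} .{{_ : NonZero B}} →
               x ℚ.* toℚ (A * (B * w)) ≡ toℚ (B * u) → x ℚ.* toℚ w ≡ (+ 1 / A) ℚ.* toℚ u
*-toℚ-cancel x w u A B eq = begin
  x ℚ.* toℚ w
    ≡⟨ sym (trans (cong₂ (λ s t → s ℚ.* t ℚ.* (x ℚ.* toℚ w)) (1/n*toℚ[n]≡1 A) (1/n*toℚ[n]≡1 B)) (ℚP.*-identityˡ _)) ⟩
  (1/A ℚ.* toℚ A) ℚ.* (1/B ℚ.* toℚ B) ℚ.* (x ℚ.* toℚ w)  ≡⟨ regroupˡ 1/A (toℚ A) 1/B (toℚ B) x (toℚ w) ⟩
  1/A ℚ.* 1/B ℚ.* (x ℚ.* (toℚ A ℚ.* (toℚ B ℚ.* toℚ w)))  ≡⟨ cong (λ t → 1/A ℚ.* 1/B ℚ.* (x ℚ.* t)) toℚ[ABw] ⟩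
  1/A ℚ.* 1/B ℚ.* (x ℚ.* toℚ (A * (B * w)))              ≡⟨ cong (1/A ℚ.* 1/B ℚ.*_) (trans eq (sym (toℚ-* B u))) ⟩
  1/A ℚ.* 1/B ℚ.* (toℚ B ℚ.* toℚ u)                      ≡⟨ regroupʳ 1/A 1/B (toℚ B) (toℚ u) ⟩
  1/A ℚ.* toℚ u ℚ.* (1/B ℚ.* toℚ B)                      ≡⟨ trans (cong (1/A ℚ.* toℚ u ℚ.*_) (1/n*toℚ[n]≡1 B)) (ℚP.*-identityʳ _) ⟩
  1/A ℚ.* toℚ u                                          ∎
  where
  open ≡-Reasoning
  open +-*-Solver using (_:*_; _:=_) renaming (solve to solveℚ)
  1/A = + 1 / A
  1/B = + 1 / B
  toℚ[ABw] : toℚ A ℚ.* (toℚ B ℚ.* toℚ w) ≡ toℚ (A * (B * w))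
  toℚ[ABw] = trans (cong (toℚ A ℚ.*_) (toℚ-* B w)) (toℚ-* A (B * w))
  regroupˡ : ∀ a A b B x w → (a ℚ.* A) ℚ.* (b ℚ.* B) ℚ.* (x ℚ.* w) ≡ a ℚ.* b ℚ.* (x ℚ.* (A ℚ.* (B ℚ.* w)))
  regroupˡ = solveℚ 6 (λ a A b B x w → (a :* A) :* (b :* B) :* (x :* w) := a :* b :* (x :* (A :* (B :* w)))) refl
  regroupʳ : ∀ a b B u → a ℚ.* b ℚ.* (B ℚ.* u) ≡ a ℚ.* u ℚ.* (b ℚ.* B)
  regroupʳ = solveℚ 4 (λ a b B u → a :* b :* (B :* u) := a :* u :* (b :* B)) refl

esymℕ : ℕ → List ℕ → ℕ
esymℕ zero    _        = 1
esymℕ (suc k) []       = 0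
esymℕ (suc k) (x ∷ xs) = x * esymℕ k xs + esymℕ (suc k) xs

-- esymᶜ k xs sums, over the k-element sets of positions, the product of the
-- entries NOT chosen.
esymᶜ : ℕ → List ℕ → ℕ
esymᶜ zero    xs       = product xs
esymᶜ (suc k) []       = 0
esymᶜ (suc k) (x ∷ xs) = esymᶜ k xs + x * esymᶜ (suc k) xs

esymℕ-length< : ∀ k xs → length xs < k → esymℕ k xs ≡ 0
esymℕ-length< (suc k) []       _          = refl
esymℕ-length< (suc k) (x ∷ xs) (s<s |xs|<k) = trans
  (cong₂ (λ s t → x * s + t) (esymℕ-length< k xs |xs|<k) (esymℕ-length< (suc k) xs (ℕP.m<n⇒m<1+n |xs|<k)))
  (cong (_+ 0) (ℕP.*-zeroʳ x))

esym-inverses : ∀ {A : Set} (f : A → ℚ) (g : A → ℕ) → (∀ x → f x ℚ.* toℚ (g x) ≡ 1ℚ) →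
                ∀ k xs → esym k (map f xs) ℚ.* toℚ (product (map g xs)) ≡ toℚ (esymᶜ k (map g xs))
esym-inverses f g inv zero    xs       = ℚP.*-identityˡ _
esym-inverses f g inv (suc k) []       = refl
esym-inverses f g inv (suc k) (x ∷ xs) = begin
  (f x ℚ.* E ℚ.+ E′) ℚ.* toℚ (g x * P)                          ≡⟨ cong ((f x ℚ.* E ℚ.+ E′) ℚ.*_) (sym (toℚ-* (g x) P)) ⟩
  (f x ℚ.* E ℚ.+ E′) ℚ.* (toℚ (g x) ℚ.* toℚ P)                  ≡⟨ expand (f x) E E′ (toℚ (g x)) (toℚ P) ⟩
  f x ℚ.* toℚ (g x) ℚ.* (E ℚ.* toℚ P) ℚ.+ toℚ (g x) ℚ.* (E′ ℚ.* toℚ P)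
    ≡⟨ cong₂ ℚ._+_ (cong₂ ℚ._*_ (inv x) (esym-inverses f g inv k xs))
                   (cong (toℚ (g x) ℚ.*_) (esym-inverses f g inv (suc k) xs)) ⟩
  1ℚ ℚ.* toℚ (esymᶜ k L) ℚ.+ toℚ (g x) ℚ.* toℚ (esymᶜ (suc k) L) ≡⟨ cong₂ ℚ._+_ (ℚP.*-identityˡ (toℚ (esymᶜ k L))) (toℚ-* (g x) (esymᶜ (suc k) L)) ⟩
  toℚ (esymᶜ k L) ℚ.+ toℚ (g x * esymᶜ (suc k) L)               ≡⟨ toℚ-+ (esymᶜ k L) (g x * esymᶜ (suc k) L) ⟩
  toℚ (esymᶜ k L + g x * esymᶜ (suc k) L)                       ∎
  where
  open ≡-Reasoning
  open +-*-Solver using (_:+_; _:*_; _:=_) renaming (solve to solveℚ)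
  E  = esym k (map f xs)
  E′ = esym (suc k) (map f xs)
  L  = map g xs
  P  = product L
  expand : ∀ t E E′ c P → (t ℚ.* E ℚ.+ E′) ℚ.* (c ℚ.* P) ≡ t ℚ.* c ℚ.* (E ℚ.* P) ℚ.+ c ℚ.* (E′ ℚ.* P)
  expand = solveℚ 5 (λ t E E′ c P → (t :* E :+ E′) :* (c :* P) := t :* c :* (E :* P) :+ c :* (E′ :* P)) refl

module _ (p : ℕ) .{{_ : NonZero p}} where

  quotients : List ℕ → List ℕ
  quotients [] = []
  quotients (x ∷ xs) with p ∣? x
  ... | yes p∣x = _∣_.quotient p∣x ∷ quotients xs
  ... | no  _   = quotients xs

  coprimePart : List ℕ → ℕ
  coprimePart [] = 1
  coprimePart (x ∷ xs) with p ∣? x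
  ... | yes _ = coprimePart xs
  ... | no  _ = x * coprimePart xs

  quotients-∷-∣ : ∀ {x m} xs → x ≡ m * p → quotients (x ∷ xs) ≡ m ∷ quotients xs
  quotients-∷-∣ {x} {m} xs x≡mp with p ∣? x
  ... | yes (divides q x≡qp) = cong (_∷ quotients xs) (ℕP.*-cancelʳ-≡ q m p (trans (sym x≡qp) x≡mp))
  ... | no  p∤x              = ⊥-elim (p∤x (divides m x≡mp))

  quotients-∤ : ∀ {xs} → All (p ∤_) xs → quotients xs ≡ []
  quotients-∤ []                      = refl
  quotients-∤ {x ∷ xs} (p∤x ∷ p∤xs) with p ∣? x
  ... | yes p∣x = ⊥-elim (p∤x p∣x)
  ... | no  _   = quotients-∤ p∤xs

  quotients-++ : ∀ xs ys → quotients (xs ++ ys) ≡ quotients xs ++ quotients ys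
  quotients-++ []       ys = refl
  quotients-++ (x ∷ xs) ys with p ∣? x
  ... | yes _ = cong (_ ∷_) (quotients-++ xs ys)
  ... | no  _ = quotients-++ xs ys

  product-split : ∀ xs → product xs ≡ p ^ length (quotients xs) * (coprimePart xs * product (quotients xs))
  product-split [] = refl
  product-split (x ∷ xs) with p ∣? x
  ... | yes (divides q refl) rewrite product-split xs = regroup p q (p ^ length (quotients xs)) (coprimePart xs) (product (quotients xs))
    where regroup : ∀ p q P U Q → q * p * (P * (U * Q)) ≡ p * P * (U * (q * Q))
          regroup = solve-∀
  ... | no  _                rewrite product-split xs = regroup x (p ^ length (quotients xs)) (coprimePart xs) (product (quotients xs))
    where regroup : ∀ x P U Q → x * (P * (U * Q)) ≡ P * (x * U * Q)
          regroup = solve-∀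

  -- The terms of esymᶜ j xs of least p-adic valuation are those keeping every
  -- non-multiple of p and exactly s multiples.
  esymᶜ-expansion : ∀ xs j s → j + s ≡ length (quotients xs) →
                    ∃[ R ] esymᶜ j xs ≡ p ^ s * (coprimePart xs * esymℕ s (quotients xs) + p * R)
  esymᶜ-expansion [] zero zero _ = 0 , unit p
    where unit : ∀ p → 1 ≡ 1 * (1 * 1 + p * 0)
          unit = solve-∀
  esymᶜ-expansion (x ∷ xs) j s e with p ∣? x
  esymᶜ-expansion (x ∷ xs) zero s e | no _ with esymᶜ-expansion xs zero s e
  ... | R , eq = x * R , trans (cong (x *_) eq) (regroup p x (p ^ s) (coprimePart xs) _ R)
    where regroup : ∀ p x P U E R → x * (P * (U * E + p * R)) ≡ P * (x * U * E + p * (x * R))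
          regroup = solve-∀
  esymᶜ-expansion (x ∷ xs) (suc j) s e | no _
    with esymᶜ-expansion xs j (suc s) (trans (ℕP.+-suc j s) e) | esymᶜ-expansion xs (suc j) s e
  ... | R₁ , eq₁ | R₂ , eq₂ =
    _ , trans (cong₂ _+_ eq₁ (cong (x *_) eq₂)) (regroup p x (p ^ s) (coprimePart xs) _ _ R₁ R₂)
    where regroup : ∀ p x P U E E′ R₁ R₂ → p * P * (U * E′ + p * R₁) + x * (P * (U * E + p * R₂))
                                         ≡ P * (x * U * E + p * (U * E′ + p * R₁ + x * R₂))
          regroup = solve-∀
  esymᶜ-expansion (_ ∷ xs) zero (suc s) e | yes (divides q refl)
    with esymᶜ-expansion xs zero s (ℕP.suc-injective e)
  ... | R , eq rewrite esymℕ-length< (suc s) (quotients xs) (ℕP.≤-reflexive (cong suc (sym (ℕP.suc-injective e)))) =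
    q * R , trans (cong (q * p *_) eq) (regroup p q (p ^ s) (coprimePart xs) _ R)
    where regroup : ∀ p q P U E R → q * p * (P * (U * E + p * R)) ≡ p * P * (U * (q * E + 0) + p * (q * R))
          regroup = solve-∀
  esymᶜ-expansion (_ ∷ xs) (suc j) zero e | yes (divides q refl)
    with esymᶜ-expansion xs j zero (ℕP.suc-injective e)
  ... | R , eq = _ , trans (cong (_+ q * p * esymᶜ (suc j) xs) eq) (regroup p q (coprimePart xs) R (esymᶜ (suc j) xs))
    where regroup : ∀ p q U R F → 1 * (U * 1 + p * R) + q * p * F ≡ 1 * (U * 1 + p * (R + q * F))
          regroup = solve-∀
  esymᶜ-expansion (_ ∷ xs) (suc j) (suc s) e | yes (divides q refl)
    with esymᶜ-expansion xs j (suc s) (ℕP.suc-injective e)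
       | esymᶜ-expansion xs (suc j) s (trans (sym (ℕP.+-suc j s)) (ℕP.suc-injective e))
  ... | R₁ , eq₁ | R₂ , eq₂ =
    _ , trans (cong₂ _+_ eq₁ (cong (q * p *_) eq₂)) (regroup p q (p ^ s) (coprimePart xs) _ _ R₁ R₂)
    where regroup : ∀ p q P U E E′ R₁ R₂ → p * P * (U * E′ + p * R₁) + q * p * (P * (U * E + p * R₂))
                                         ≡ p * P * (U * (q * E + E′) + p * (R₁ + q * R₂))
          regroup = solve-∀

  pow-neg : ∀ K → pow p (ℤ.- (+ K)) ≡ (+ 1 / p ^ K) {{ℕP.m^n≢0 p K}}
  pow-neg zero    = refl
  pow-neg (suc K) = refl

  hasValuation-neg : ∀ x K ε u w → p ∤ u → p ∤ w →
                     x ℚ.* toℚ (p ^ K * (p ^ ε * w)) ≡ toℚ (p ^ ε * u) → HasValuation p x (ℤ.- (+ K))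
  hasValuation-neg x K ε u w p∤u p∤w x*pᴷ⁺ᵋw≡pᵋu = x≢0 , + u , + w , w≢0 , p∤u , p∤w , x*w≡p⁻ᴷ*u
    where
    instance
      _ = ℕP.m^n≢0 p K
      _ = ℕP.m^n≢0 p ε

    x*w≡p⁻ᴷ*u : x ℚ.* toℚ w ≡ pow p (ℤ.- (+ K)) ℚ.* toℚ u
    x*w≡p⁻ᴷ*u = trans (*-toℚ-cancel x w u (p ^ K) (p ^ ε) x*pᴷ⁺ᵋw≡pᵋu) (cong (ℚ._* toℚ u) (sym (pow-neg K)))

    w≢0 : ¬ (+ w ≡ + 0)
    w≢0 w≡0 = p∤w (subst (p ∣_) (sym (ℤP.+-injective w≡0)) (p ∣0))

    x≢0 : ¬ x ≡ 0ℚ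
    x≢0 x≡0 = p∤u (subst (p ∣_) (sym u≡0) (p ∣0))
      where
      pᵋu≡0 : p ^ ε * u ≡ 0
      pᵋu≡0 = toℚ-injective (trans (sym x*pᴷ⁺ᵋw≡pᵋu)
        (trans (cong (ℚ._* toℚ (p ^ K * (p ^ ε * w))) x≡0) (ℚP.*-zeroˡ (toℚ (p ^ K * (p ^ ε * w))))))
      u≡0 : u ≡ 0
      u≡0 = ℕP.m*n≡0⇒m≡0 u (p ^ ε) (trans (ℕP.*-comm u (p ^ ε)) pᵋu≡0)

  module _ (prime : Prime p) where

    p∤* : ∀ {m n} → p ∤ m → p ∤ n → p ∤ m * n
    p∤* {m} {n} p∤m p∤n p∣mn = [ p∤m , p∤n ]′ (euclidsLemma m n prime p∣mn)

    p∤1 : p ∤ 1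
    p∤1 = >⇒∤ (ℕ.nonTrivial⇒n>1 p {{prime⇒nonTrivial prime}})

    p∤product : ∀ {xs} → All (p ∤_) xs → p ∤ product xs
    p∤product []            = p∤1
    p∤product (p∤x ∷ p∤xs) = p∤* p∤x (p∤product p∤xs)

    p∤coprimePart : ∀ xs → p ∤ coprimePart xs
    p∤coprimePart []       = p∤1
    p∤coprimePart (x ∷ xs) with p ∣? x
    ... | yes _   = p∤coprimePart xs
    ... | no  p∤x = p∤* p∤x (p∤coprimePart xs)

    esymᶜ-split : ∀ xs K ε → length (quotients xs) ≡ K + ε →
                  p ∤ esymℕ ε (quotients xs) → p ∤ product (quotients xs) →
                  ∃[ u ] ∃[ w ] p ∤ u × p ∤ w × esymᶜ K xs ≡ p ^ ε * u × product xs ≡ p ^ K * (p ^ ε * w)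
    esymᶜ-split xs K ε |M|≡K+ε p∤eε p∤ΠM with esymᶜ-expansion xs K ε (sym |M|≡K+ε)
    ... | R , esymᶜ≡ = U * esymℕ ε M + p * R , w , p∤u , p∤* (p∤coprimePart xs) p∤ΠM , esymᶜ≡ , product≡
      where
      open ≡-Reasoning
      M = quotients xs
      U = coprimePart xs
      w = U * product M

      p∤u : p ∤ U * esymℕ ε M + p * R
      p∤u p∣u = p∤* (p∤coprimePart xs) p∤eε (∣m+n∣m⇒∣n (subst (p ∣_) (ℕP.+-comm _ (p * R)) p∣u) (m∣m*n R))

      product≡ : product xs ≡ p ^ K * (p ^ ε * w)
      product≡ = begin
        product xs          ≡⟨ product-split xs ⟩
        p ^ length M * w    ≡⟨ cong (λ e → p ^ e * w) |M|≡K+ε ⟩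
        p ^ (K + ε) * w     ≡⟨ cong (_* w) (ℕP.^-distribˡ-+-* p K ε) ⟩
        p ^ K * p ^ ε * w   ≡⟨ ℕP.*-assoc (p ^ K) (p ^ ε) w ⟩
        p ^ K * (p ^ ε * w) ∎

    esym-valuation : ∀ {A : Set} (f : A → ℚ) (g : A → ℕ) → (∀ x → f x ℚ.* toℚ (g x) ≡ 1ℚ) →
                     ∀ xs K ε → length (quotients (map g xs)) ≡ K + ε →
                     p ∤ esymℕ ε (quotients (map g xs)) → p ∤ product (quotients (map g xs)) →
                     HasValuation p (esym K (map f xs)) (ℤ.- (+ K))
    esym-valuation f g inv xs K ε |M|≡K+ε p∤eε p∤ΠM with esymᶜ-split (map g xs) K ε |M|≡K+ε p∤eε p∤ΠM
    ... | u , w , p∤u , p∤w , esymᶜ≡ , product≡ = hasValuation-neg (esym K (map f xs)) K ε u w p∤u p∤w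
      (subst₂ (λ P E → esym K (map f xs) ℚ.* toℚ P ≡ toℚ E) product≡ esymᶜ≡ (esym-inverses f g inv K xs))

applyUpTo-++ : ∀ {A : Set} (f : ℕ → A) m n → applyUpTo f (m + n) ≡ applyUpTo f m ++ applyUpTo (λ i → f (m + i)) n
applyUpTo-++ f zero    n = refl
applyUpTo-++ f (suc m) n = cong (f 0 ∷_) (applyUpTo-++ (f ∘ suc) m n)

∃-root : ∀ {p a} .{{_ : NonZero p}} b → Coprime p a → ∃[ i ] p ∣ a * i + b
∃-root {suc q} {a} b p⊥a with coprime-Bézout p⊥a
... | Bézout.+- x y 1+ya≡xp =
  y * b , divides (x * b) (trans (regroup a y b) (trans (cong (_* b) 1+ya≡xp) (swap x (suc q) b)))
  where
  regroup : ∀ a y b → a * (y * b) + b ≡ (1 + y * a) * b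
  regroup = solve-∀
  swap : ∀ x p b → x * p * b ≡ x * b * p
  swap = solve-∀
... | Bézout.-+ x y 1+xp≡ya =
  y * (b * q) , divides (b + x * (b * q))
    (trans (regroup a y (b * q) b) (trans (cong (λ t → t * (b * q) + b) (sym 1+xp≡ya)) (expand x q b)))
  where
  regroup : ∀ a y c b → a * (y * c) + b ≡ y * a * c + b
  regroup = solve-∀
  expand : ∀ x q b → (1 + x * (1 + q)) * (b * q) + b ≡ (b + x * (b * q)) * (1 + q)
  expand = solve-∀

∃-root< : ∀ {p a} .{{_ : NonZero p}} b → Coprime p a → ∃[ i ] i < p × p ∣ a * i + b
∃-root< {p} {a} b p⊥a with ∃-root b p⊥a
... | i , p∣ai+b = i % p , m%n<n i p , ∣m+n∣m⇒∣n (subst (p ∣_) reduce p∣ai+b) (∣n⇒∣m*n a (n∣m*n (i div p)))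
  where
  open ≡-Reasoning
  reduce : a * i + b ≡ a * (i div p * p) + (a * (i % p) + b)
  reduce = begin
    a * i + b                         ≡⟨ cong (λ j → a * j + b) (m≡m%n+[m/n]*n i p) ⟩
    a * (i % p + i div p * p) + b     ≡⟨ regroup a (i % p) (i div p * p) b ⟩
    a * (i div p * p) + (a * (i % p) + b) ∎
    where regroup : ∀ a r k b → a * (r + k) + b ≡ a * k + (a * r + b)
          regroup = solve-∀

∃-blocks : ∀ p .{{_ : NonZero p}} ℓ → ∃[ c ] ∃[ r ] 0 < r × r ≤ p × suc ℓ ≡ c * p + r
∃-blocks p ℓ = ℓ div p , suc (ℓ % p) , z<s , m%n<n ℓ p ,
  trans (cong suc (trans (m≡m%n+[m/n]*n ℓ p) (ℕP.+-comm (ℓ % p) _))) (sym (ℕP.+-suc _ (ℓ % p)))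

progression : ℕ → ℕ → ℕ → List ℕ
progression a m zero    = []
progression a m (suc c) = m ∷ progression a (m + a) c

length-progression : ∀ a m c → length (progression a m c) ≡ c
length-progression a m zero    = refl
length-progression a m (suc c) = cong suc (length-progression a (m + a) c)

2*esym₁-progression : ∀ a m c → 2 * esymℕ 1 (progression a m (suc c)) ≡ suc c * (2 * m + a * c)
2*esym₁-progression a m zero    = base m a
  where base : ∀ m a → 2 * (m * 1 + 0) ≡ 1 * (2 * m + a * 0)
        base = solve-∀
2*esym₁-progression a m (suc c) = begin
  2 * (m * 1 + E)                            ≡⟨ distrib m E ⟩
  2 * m + 2 * E                              ≡⟨ cong (λ t → 2 * m + t) (2*esym₁-progression a (m + a) c) ⟩
  2 * m + suc c * (2 * (m + a) + a * c)      ≡⟨ regroup m a c ⟩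
  suc (suc c) * (2 * m + a * suc c)          ∎
  where
  open ≡-Reasoning
  E = esymℕ 1 (progression a (m + a) (suc c))
  distrib : ∀ m E → 2 * (m * 1 + E) ≡ 2 * m + 2 * E
  distrib = solve-∀
  regroup : ∀ m a c → 2 * m + (1 + c) * (2 * (m + a) + a * c) ≡ (2 + c) * (2 * m + a * (1 + c))
  regroup = solve-∀

module _ {p a : ℕ} .{{_ : NonZero p}} (prime : Prime p) (0<a : 0 < a) (a<p : a < p) where

  0<t<p⇒p∤t : ∀ {t} → 0 < t → t < p → p ∤ t
  0<t<p⇒p∤t 0<t t<p = >⇒∤ {{>-nonZero 0<t}} t<p

  p∣x⇒p∤x+a*t : ∀ {x t} → p ∣ x → 0 < t → t < p → p ∤ x + a * t
  p∣x⇒p∤x+a*t {x} {t} p∣x 0<t t<p p∣x+at =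
    [ 0<t<p⇒p∤t 0<a a<p , 0<t<p⇒p∤t 0<t t<p ]′ (euclidsLemma a t prime (∣m+n∣m⇒∣n p∣x+at p∣x))

  p∤progression : ∀ {m} c → 0 < m → m + a * c < p → All (p ∤_) (progression a m (suc c))
  p∤progression {m} zero    0<m m+a*0<p = 0<t<p⇒p∤t 0<m (ℕP.≤-<-trans (ℕP.m≤m+n m _) m+a*0<p) ∷ []
  p∤progression {m} (suc c) 0<m m+ac<p =
    0<t<p⇒p∤t 0<m (ℕP.≤-<-trans (ℕP.m≤m+n m _) m+ac<p) ∷
    p∤progression c (ℕP.<-≤-trans 0<m (ℕP.m≤m+n m a)) (subst (_< p) (shift m a c) m+ac<p)
    where shift : ∀ m a c → m + a * (1 + c) ≡ m + a + a * c
          shift = solve-∀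

  p∤esym₁-progression : ∀ {m c} → 0 < m → suc c < p → 2 * m + a * c < p → p ∤ esymℕ 1 (progression a m (suc c))
  p∤esym₁-progression {m} {c} 0<m 1+c<p 2m+ac<p p∣e₁ =
    p∤* p prime (0<t<p⇒p∤t z<s 1+c<p) (0<t<p⇒p∤t 0<2m+ac 2m+ac<p) (subst (p ∣_) (2*esym₁-progression a m c) (∣n⇒∣m*n 2 p∣e₁))
    where 0<2m+ac = ℕP.<-≤-trans 0<m (ℕP.≤-trans (ℕP.m≤m+n m (m + 0)) (ℕP.m≤m+n (2 * m) (a * c)))

  quotients-window : ∀ m (g : ℕ → ℕ) r → (∀ t → g t ≡ m * p + a * t) → 0 < r → r ≤ p →
                     quotients p (applyUpTo g r) ≡ m ∷ []
  quotients-window m g (suc r) g≡ _ r≤p = trans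
    (quotients-∷-∣ p (applyUpTo (g ∘ suc) r) (trans (g≡ 0) (at0 m p a)))
    (cong (m ∷_) (quotients-∤ p (applyUpTo⁺₁ (g ∘ suc) r p∤g[1+t])))
    where
    at0 : ∀ m p a → m * p + a * 0 ≡ m * p
    at0 = solve-∀
    p∤g[1+t] : ∀ {t} → t < r → p ∤ g (suc t)
    p∤g[1+t] {t} t<r = subst (p ∤_) (sym (g≡ (suc t))) (p∣x⇒p∤x+a*t (n∣m*n m) z<s (ℕP.<-≤-trans (s<s t<r) r≤p))

  quotients-blocks : ∀ c m (g : ℕ → ℕ) r → (∀ t → g t ≡ m * p + a * t) → 0 < r → r ≤ p →
                     quotients p (applyUpTo g (c * p + r)) ≡ progression a m (suc c)
  quotients-blocks zero    m g r g≡ 0<r r≤p = quotients-window m g r g≡ 0<r r≤p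
  quotients-blocks (suc c) m g r g≡ 0<r r≤p = begin
    quotients p (applyUpTo g (p + c * p + r))
      ≡⟨ cong (quotients p) (trans (cong (applyUpTo g) (ℕP.+-assoc p (c * p) r)) (applyUpTo-++ g p (c * p + r))) ⟩
    quotients p (applyUpTo g p ++ applyUpTo (λ t → g (p + t)) (c * p + r))
      ≡⟨ quotients-++ p (applyUpTo g p) _ ⟩
    quotients p (applyUpTo g p) ++ quotients p (applyUpTo (λ t → g (p + t)) (c * p + r))
      ≡⟨ cong₂ _++_ (quotients-window m g p g≡ (>-nonZero⁻¹ p) ℕP.≤-refl)
                    (quotients-blocks c (m + a) (λ t → g (p + t)) r g[p+t]≡ 0<r r≤p) ⟩
    m ∷ progression a (m + a) (suc c)
      ∎
    where
    open ≡-Reasoning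
    shift : ∀ m p a t → m * p + a * (p + t) ≡ (m + a) * p + a * t
    shift = solve-∀
    g[p+t]≡ : ∀ t → g (p + t) ≡ (m + a) * p + a * t
    g[p+t]≡ t = trans (g≡ (p + t)) (shift m p a t)

  multiples-in-progression : ∀ b {n i₀ m} → i₀ < p → i₀ < n → a * i₀ + b ≡ m * p →
    ∃[ c ] ∃[ r ] 0 < r × r ≤ p × n ≡ i₀ + (c * p + r) ×
                  quotients p (map (λ i → a * i + b) (upTo n)) ≡ progression a m (suc c)
  multiples-in-progression b {n} {i₀} {m} i₀<p i₀<n d[i₀]≡mp with ∃-blocks p (n ∸ suc i₀)
  ... | c , r , 0<r , r≤p , 1+ℓ≡cp+r = c , r , 0<r , r≤p , n≡ , (begin
    quotients p (map d (upTo n))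
      ≡⟨ cong (quotients p) (trans (map-upTo d n) (trans (cong (applyUpTo d) n≡) (applyUpTo-++ d i₀ (c * p + r)))) ⟩
    quotients p (applyUpTo d i₀ ++ applyUpTo (λ t → d (i₀ + t)) (c * p + r))
      ≡⟨ quotients-++ p (applyUpTo d i₀) _ ⟩
    quotients p (applyUpTo d i₀) ++ quotients p (applyUpTo (λ t → d (i₀ + t)) (c * p + r))
      ≡⟨ cong₂ _++_ (quotients-∤ p (applyUpTo⁺₁ d i₀ p∤d[t]))
                    (quotients-blocks c m (λ t → d (i₀ + t)) r d[i₀+t]≡ 0<r r≤p) ⟩
    progression a m (suc c)
      ∎)
    where
    open ≡-Reasoning
    d : ℕ → ℕ
    d i = a * i + b

    d[i+t] : ∀ i t → d (i + t) ≡ d i + a * t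
    d[i+t] i t = shift a i t b
      where shift : ∀ a i t b → a * (i + t) + b ≡ a * i + b + a * t
            shift = solve-∀

    n≡ : n ≡ i₀ + (c * p + r)
    n≡ = trans (sym (ℕP.m+[n∸m]≡n i₀<n)) (trans (sym (ℕP.+-suc i₀ (n ∸ suc i₀))) (cong (λ t → i₀ + t) 1+ℓ≡cp+r))

    d[i₀+t]≡ : ∀ t → d (i₀ + t) ≡ m * p + a * t
    d[i₀+t]≡ t = trans (d[i+t] i₀ t) (cong (_+ a * t) d[i₀]≡mp)

    p∤d[t] : ∀ {t} → t < i₀ → p ∤ d t
    p∤d[t] {t} t<i₀ p∣d[t] = p∣x⇒p∤x+a*t p∣d[t] (ℕP.m<n⇒0<n∸m t<i₀) (ℕP.≤-<-trans (ℕP.m∸n≤m i₀ t) i₀<p)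
      (divides m (trans (sym (d[i+t] t (i₀ ∸ t))) (trans (cong d (ℕP.m+[n∸m]≡n (ℕP.<⇒≤ t<i₀))) d[i₀]≡mp)))

drop‿+*+<+*+ : ∀ m n o q → + m ℤ.* + n ℤ.< + o ℤ.* + q → m * n < o * q
drop‿+*+<+*+ m n o q = ℤP.drop‿+<+ ∘ subst₂ ℤ._<_ (sym (ℤP.pos-* m n)) (sym (ℤP.pos-* o q))

drop‿+*+≤+*+ : ∀ m n o q → + m ℤ.* + n ℤ.≤ + o ℤ.* + q → m * n ≤ o * q
drop‿+*+≤+*+ m n o q = ℤP.drop‿+≤+ ∘ subst₂ ℤ._≤_ (sym (ℤP.pos-* m n)) (sym (ℤP.pos-* o q))

x/1+y/q<z/1⇒ : ∀ x y z q .{{_ : NonZero q}} → (+ x) / 1 ℚ.+ (+ y) / q ℚ.< (+ z) / 1 → x * q + y < z * q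
x/1+y/q<z/1⇒ x y z q lt = ℤP.drop‿+<+ (subst₂ ℤ._<_ lhs rhs
  (/-<-/⇒ (+ x ℤ.* + q ℤ.+ + y ℤ.* + 1) (+ z) (1 * q) 1 {{ℕP.m*n≢0 1 q}} (subst (ℚ._< (+ z) / 1) (/-+-/ (+ x) (+ y) 1 q) lt)))
  where
  lhs : (+ x ℤ.* + q ℤ.+ + y ℤ.* + 1) ℤ.* + 1 ≡ + (x * q + y)
  lhs = trans (ℤP.*-identityʳ _)
    (trans (cong₂ ℤ._+_ (sym (ℤP.pos-* x q)) (ℤP.*-identityʳ (+ y))) (sym (ℤP.pos-+ (x * q) y)))
  rhs : + z ℤ.* + (1 * q) ≡ + (z * q)
  rhs = trans (sym (ℤP.pos-* z (1 * q))) (cong (λ t → + (z * t)) (ℕP.*-identityˡ q))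

module _ {a b n k p : ℕ} .{{_ : NonZero a}} .{{_ : NonZero b}} .{{_ : NonZero k}} .{{_ : NonZero p}}
         (prime : Prime p) (n<p[1+k] : n < p * suc k) (pk≤n : p * k ≤ n)
         (bound : (a * k + 2 * a) * p + 2 * b < p * p) where

  d : ℕ → ℕ
  d i = a * i + b

  0<a : 0 < a
  0<a = >-nonZero⁻¹ a

  ak+2a<p : a * k + 2 * a < p
  ak+2a<p = ℕP.*-cancelʳ-< p _ p (ℕP.≤-<-trans (ℕP.m≤m+n _ (2 * b)) bound)

  a<p : a < p
  a<p = ℕP.≤-<-trans (ℕP.≤-trans (ℕP.m≤m+n a (a + 0)) (ℕP.m≤n+m (2 * a) (a * k))) ak+2a<p

  1+k<p : suc k < p
  1+k<p = ℕP.≤-<-trans (subst (_≤ a * k + 2 * a) (ℕP.+-comm k 1)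
    (ℕP.+-mono-≤ (ℕP.m≤n*m k a) (ℕP.≤-trans 0<a (ℕP.m≤m+n a (a + 0))))) ak+2a<p

  p≤n : p ≤ n
  p≤n = ℕP.≤-trans (ℕP.m≤m*n p k) pk≤n

  quotient-pos : ∀ {i₀ m} → d i₀ ≡ m * p → 0 < m
  quotient-pos {i₀} {zero}  d[i₀]≡0 = ⊥-elim (ℕ.≢-nonZero⁻¹ b (ℕP.m+n≡0⇒n≡0 (a * i₀) d[i₀]≡0))
  quotient-pos {_}  {suc _} _       = z<s

  2m+ak<p : ∀ {i₀ m} → i₀ < p → d i₀ ≡ m * p → 2 * m + a * k < p
  2m+ak<p {i₀} {m} i₀<p d[i₀]≡mp = ℕP.*-cancelʳ-< p _ p (begin-strict
    (2 * m + a * k) * p           ≡⟨ distrib m p a k ⟩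
    2 * (m * p) + a * k * p       ≡⟨ cong (λ t → 2 * t + a * k * p) (sym d[i₀]≡mp) ⟩
    2 * (a * i₀ + b) + a * k * p  ≤⟨ ℕP.+-monoˡ-≤ (a * k * p) (ℕP.*-monoʳ-≤ 2 (ℕP.+-monoˡ-≤ b (ℕP.*-monoʳ-≤ a (ℕP.<⇒≤ i₀<p)))) ⟩
    2 * (a * p + b) + a * k * p   ≡⟨ regroup a p b k ⟩
    (a * k + 2 * a) * p + 2 * b   <⟨ bound ⟩
    p * p                         ∎)
    where
    open ℕP.≤-Reasoning
    distrib : ∀ m p a k → (2 * m + a * k) * p ≡ 2 * (m * p) + a * k * p
    distrib = solve-∀
    regroup : ∀ a p b k → 2 * (a * p + b) + a * k * p ≡ (a * k + 2 * a) * p + 2 * b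
    regroup = solve-∀

  blocks≤k : ∀ {i₀ c r} → 0 < r → n ≡ i₀ + (c * p + r) → c ≤ k
  blocks≤k {i₀} {c} {r} 0<r n≡ = ℕP.≤-pred (ℕP.*-cancelʳ-< p c (suc k) (begin-strict
    c * p             <⟨ ℕP.m<m+n (c * p) 0<r ⟩
    c * p + r         ≤⟨ ℕP.m≤n+m (c * p + r) i₀ ⟩
    i₀ + (c * p + r)  ≡⟨ sym n≡ ⟩
    n                 <⟨ n<p[1+k] ⟩
    p * suc k         ≡⟨ ℕP.*-comm p (suc k) ⟩
    suc k * p         ∎))
    where open ℕP.≤-Reasoning

  k≤1+blocks : ∀ {i₀ c r} → i₀ < p → r ≤ p → n ≡ i₀ + (c * p + r) → k ≤ suc c
  k≤1+blocks {i₀} {c} {r} i₀<p r≤p n≡ = ℕP.≤-pred (ℕP.*-cancelʳ-< p k (2 + c) (begin-strict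
    k * p             ≡⟨ ℕP.*-comm k p ⟩
    p * k             ≤⟨ pk≤n ⟩
    n                 ≡⟨ n≡ ⟩
    i₀ + (c * p + r)  <⟨ ℕP.+-mono-<-≤ i₀<p (ℕP.+-monoʳ-≤ (c * p) r≤p) ⟩
    p + (c * p + p)   ≡⟨ regroup p c ⟩
    (2 + c) * p       ∎))
    where
    open ℕP.≤-Reasoning
    regroup : ∀ p c → p + (c * p + p) ≡ (2 + c) * p
    regroup = solve-∀

  valuation-from-blocks : ∀ {i₀ m c r} → i₀ < p → d i₀ ≡ m * p → 0 < r → r ≤ p → n ≡ i₀ + (c * p + r) →
                          quotients p (map d (upTo n)) ≡ progression a m (suc c) →
                          HasValuation p (S a b n k) (ℤ.- (+ k))
  valuation-from-blocks {i₀} {m} {c} {r} i₀<p d[i₀]≡mp 0<r r≤p n≡ M≡ =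
    [ (λ k<1+c → k≡c⇒valuation (ℕP.≤-antisym (ℕP.≤-pred k<1+c) c≤k)) , k≡1+c⇒valuation ]′
      (ℕP.m≤n⇒m<n∨m≡n (k≤1+blocks i₀<p r≤p n≡))
    where
    M = quotients p (map d (upTo n))

    c≤k : c ≤ k
    c≤k = blocks≤k {i₀} 0<r n≡

    0<m : 0 < m
    0<m = quotient-pos {i₀} {m} d[i₀]≡mp

    2m+ac<p : 2 * m + a * c < p
    2m+ac<p = ℕP.≤-<-trans (ℕP.+-monoʳ-≤ (2 * m) (ℕP.*-monoʳ-≤ a c≤k)) (2m+ak<p {i₀} {m} i₀<p d[i₀]≡mp)

    m+ac<p : m + a * c < p
    m+ac<p = ℕP.≤-<-trans (ℕP.+-monoˡ-≤ (a * c) (ℕP.m≤m+n m (m + 0))) 2m+ac<p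

    p∤ΠM : p ∤ product M
    p∤ΠM = subst (λ L → p ∤ product L) (sym M≡) (p∤product p prime (p∤progression prime 0<a a<p {m} c 0<m m+ac<p))

    valuation : ∀ ε → suc c ≡ k + ε → p ∤ esymℕ ε M → HasValuation p (S a b n k) (ℤ.- (+ k))
    valuation ε 1+c≡k+ε p∤eε = esym-valuation p prime (term a b) d (λ i → 1/n*toℚ[n]≡1 (d i) {{nonZero-ai+b a i b}})
      (upTo n) k ε (trans (trans (cong length M≡) (length-progression a m (suc c))) 1+c≡k+ε) p∤eε p∤ΠM

    k≡1+c⇒valuation : k ≡ suc c → HasValuation p (S a b n k) (ℤ.- (+ k))
    k≡1+c⇒valuation k≡1+c = valuation 0 (trans (sym k≡1+c) (sym (ℕP.+-identityʳ k))) (p∤1 p prime)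

    k≡c⇒valuation : k ≡ c → HasValuation p (S a b n k) (ℤ.- (+ k))
    k≡c⇒valuation k≡c = valuation 1 (trans (cong suc (sym k≡c)) (ℕP.+-comm 1 k))
      (subst (λ L → p ∤ esymℕ 1 L) (sym M≡)
        (p∤esym₁-progression prime 0<a a<p 0<m (subst (λ t → suc t < p) k≡c 1+k<p) 2m+ac<p))

  S-valuation : HasValuation p (S a b n k) (ℤ.- (+ k))
  S-valuation with ∃-root< b (prime⇒coprime prime {{>-nonZero 0<a}} a<p)
  ... | i₀ , i₀<p , divides m d[i₀]≡mp
    with multiples-in-progression prime 0<a a<p b {n} {i₀} {m} i₀<p (ℕP.<-≤-trans i₀<p p≤n) d[i₀]≡mp
  ... | c , r , 0<r , r≤p , n≡ , M≡ = valuation-from-blocks i₀<p d[i₀]≡mp 0<r r≤p n≡ M≡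

lemma2p5 : (a b n k p : ℕ) → .{{_ : NonZero a}} → .{{_ : NonZero b}} →
    .{{_ : NonZero n}} → .{{_ : NonZero k}} → .{{_ : NonZero p}} →
    1 ≤ k → k ≤ n → Prime p →
    (+ n) / (ℕ.suc k) ℚ.< (+ p) / 1 →
    (+ p) / 1 ℚ.≤ (+ n) / k →
    (+ (a ℕ.* k ℕ.+ 2 ℕ.* a)) / 1 ℚ.+ (+ (2 ℕ.* b)) / p ℚ.< (+ p) / 1 →
    HasValuation p (S a b n k) (ℤ.- (+ k))
lemma2p5 a b n k p _ _ p-prime n/[1+k]<p p≤n/k bound = S-valuation {a} {b} {n} {k} {p} p-prime
  (subst (_< p * suc k) (ℕP.*-identityʳ n) (drop‿+*+<+*+ n 1 p (suc k) (/-<-/⇒ (+ n) (+ p) (suc k) 1 n/[1+k]<p)))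
  (subst (p * k ≤_) (ℕP.*-identityʳ n) (drop‿+*+≤+*+ p k n 1 (/-≤-/⇒ (+ p) (+ n) 1 k p≤n/k)))
  (x/1+y/q<z/1⇒ (a * k + 2 * a) (2 * b) p p bound)
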